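{- Let $\Sigma=\{0\}$ and let $\mathbf{G}$ be the graph whose vertex set is the set of all finite $1$-parameter words over $\Sigma$ (finite strings over $\{0,\lambda_0\}$ containing $\lambda_0$), in which two vertices $U,V$ with $|U|<|V|$ are adjacent if and only if (i) $V_{|U|}=\lambda_0$ and (ii) there is no $0\le j<|U|$ with $U_j=V_j=\lambda_0$ (and there are no other edges; in particular vertices of equal length are non-adjacent). Then $\mathbf{G}$ is triangle-free.
   Context: For a string $W$, $|W|$ denotes its length and $W_j$ its letter at index $j$, indices starting at $0$. -}

module Defs where

open import Data.Nat using (ℕ; _<_)
open import Data.List using (List; length; lookup)
open import Data.List.Relation.Unary.Any using (Any)
open import Data.Fin using (Fin; toℕ)
open import Data.Product using (Σ; ∃; ∃-syntax; _×_; proj₁)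
open import Data.Sum using (_⊎_)
open import Relation.Binary.PropositionalEquality using (_≡_)
open import Relation.Nullary using (¬_)
open import Data.Empty using (⊥)

data Letter : Set where
  𝟘  : Letter
  λ₀ : Letter

Word : Set
Word = List Letter

IsParamWord : Word → Set
IsParamWord W = Any (_≡ λ₀) W

Vertex : Set
Vertex = Σ Word IsParamWord

_at_ : (W : Word) → Fin (length W) → Letter
W at j = lookup W j

EdgeUp : Word → Word → Set
EdgeUp U V =
  Σ (length U < length V) λ lt →
    (∃[ i ] (toℕ i ≡ length U × V at i ≡ λ₀))
    × ¬ (∃[ j ] ∃[ k ] (toℕ j ≡ toℕ k × U at j ≡ λ₀ × V at k ≡ λ₀))

Adj : Vertex → Vertex → Set
Adj U V = EdgeUp (proj₁ U) (proj₁ V) ⊎ EdgeUp (proj₁ V) (proj₁ U)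

-- Triangle-free: no three pairwise adjacent vertices.
-- (Adj is irreflexive, since it forces strictly different lengths.)
TriangleFree : (Vertex → Vertex → Set) → Set
TriangleFree E = ∀ U V W → E U V → E V W → E U W → ⊥

module Submission where

open import Defs
open import Data.Nat using (ℕ)
open import Data.Nat.Properties using (<-trans; <-irrefl)
open import Data.Product using (_,_; ∃-syntax; _×_)
open import Data.Fin using (toℕ)
open import Data.List using (length)
open import Data.Sum using (inj₁; inj₂)
open import Relation.Binary.PropositionalEquality using (_≡_; refl; trans; sym)
open import Relation.Nullary using (¬_)

-- The shortest vertex A of a triangle has edges up to both others, B and C,
-- so B and C both carry λ₀ at position |A|, which lies below both their
-- lengths; condition (ii) then forbids an edge between B and C either way.

λ₀At : Word → ℕ → Set
λ₀At W n = ∃[ i ] (toℕ i ≡ n × W at i ≡ λ₀)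

EdgeUp⇒λ₀At-length : ∀ U V → EdgeUp U V → λ₀At V (length U)
EdgeUp⇒λ₀At-length _ _ (_ , λ₀-at , _) = λ₀-at

EdgeUp⇒¬shared-λ₀ : ∀ U V n → EdgeUp U V → λ₀At U n → ¬ λ₀At V n
EdgeUp⇒¬shared-λ₀ _ _ n (_ , _ , disjoint) (j , j≡n , Uj) (k , k≡n , Vk) =
  disjoint (j , k , trans j≡n (sym k≡n) , Uj , Vk)

EdgeUp-common-source⇒¬EdgeUp : ∀ A B C → EdgeUp A B → EdgeUp A C → ¬ EdgeUp B C
EdgeUp-common-source⇒¬EdgeUp A B C AB AC BC =
  EdgeUp⇒¬shared-λ₀ B C (length A) BC
    (EdgeUp⇒λ₀At-length A B AB) (EdgeUp⇒λ₀At-length A C AC)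

EdgeUp-acyclic₃ : ∀ A B C → EdgeUp A B → EdgeUp B C → ¬ EdgeUp C A
EdgeUp-acyclic₃ _ _ _ (A<B , _) (B<C , _) (C<A , _) =
  <-irrefl refl (<-trans (<-trans A<B B<C) C<A)

lemma4p2 : TriangleFree Adj
lemma4p2 (U , _) (V , _) (W , _) (inj₁ UV) (inj₁ VW) (inj₁ UW) =
  EdgeUp-common-source⇒¬EdgeUp U V W UV UW VW
lemma4p2 (U , _) (V , _) (W , _) (inj₁ UV) (inj₁ VW) (inj₂ WU) =
  EdgeUp-acyclic₃ U V W UV VW WU
lemma4p2 (U , _) (V , _) (W , _) (inj₁ UV) (inj₂ WV) (inj₁ UW) =
  EdgeUp-common-source⇒¬EdgeUp U W V UW UV WV
lemma4p2 (U , _) (V , _) (W , _) (inj₁ UV) (inj₂ WV) (inj₂ WU) =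
  EdgeUp-common-source⇒¬EdgeUp W U V WU WV UV
lemma4p2 (U , _) (V , _) (W , _) (inj₂ VU) (inj₁ VW) (inj₁ UW) =
  EdgeUp-common-source⇒¬EdgeUp V U W VU VW UW
lemma4p2 (U , _) (V , _) (W , _) (inj₂ VU) (inj₁ VW) (inj₂ WU) =
  EdgeUp-common-source⇒¬EdgeUp V W U VW VU WU
lemma4p2 (U , _) (V , _) (W , _) (inj₂ VU) (inj₂ WV) (inj₁ UW) =
  EdgeUp-acyclic₃ U W V UW WV VU
lemma4p2 (U , _) (V , _) (W , _) (inj₂ VU) (inj₂ WV) (inj₂ WU) =
  EdgeUp-common-source⇒¬EdgeUp W V U WV WU VU
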